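{- Let $G$ be a strongly connected compressed directed graph that is not a closed path, and let $u$ be a bivalent node of $G$. No omnitig of $G$ contains $u$ twice as an internal node.
   Context: Graphs are finite directed multigraphs (parallel arcs and self-loops allowed); $t(e)$, $h(e)$ are tail and head of arc $e$. A walk $(v_0,e_1,v_1,\dots,e_\ell,v_\ell)$ has internal nodes $v_1,\dots,v_{\ell-1}$ (counted with multiplicity); a path is a walk with distinct nodes except $v_\ell=v_0$ allowed. A closed path is a graph consisting of a single cycle. A node is a join node if its in-degree exceeds 1, a split node if its out-degree exceeds 1, bivalent if both, biunivocal if neither; an arc is biunivocal if its head has in-degree 1 and its tail out-degree 1. A graph is compressed if it has no biunivocal nodes and no biunivocal arcs. A walk $W=e_0\dots e_\ell$ is an omnitig if for all $1\le i\le j\le \ell$ there is no non-empty path from $t(e_j)$ to $h(e_{i-1})$ whose first arc differs from $e_j$ and whose last arc differs from $e_{i-1}$. -}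

module Defs where

open import Data.Nat using (ℕ; zero; suc; _<_; _≤_)
open import Data.Fin using (Fin; zero; suc; toℕ; inject₁; fromℕ; _≟_)
open import Data.List using (List; length; filter; allFin)
open import Data.Product using (Σ; ∃; _×_; _,_)
open import Data.Sum using (_⊎_)
open import Relation.Nullary using (¬_)
open import Relation.Binary.PropositionalEquality using (_≡_; _≢_)

record Graph : Set where
  field
    V    : ℕ
    E    : ℕ
    tail : Fin E → Fin V
    head : Fin E → Fin V

open Graph public

Node : Graph → Set
Node G = Fin (V G)

Arc : Graph → Set
Arc G = Fin (E G)

inDeg : (G : Graph) → Node G → ℕ
inDeg G v = length (filter (λ e → head G e ≟ v) (allFin (E G)))

outDeg : (G : Graph) → Node G → ℕ
outDeg G v = length (filter (λ e → tail G e ≟ v) (allFin (E G)))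

JoinNode : (G : Graph) → Node G → Set
JoinNode G v = 1 < inDeg G v

SplitNode : (G : Graph) → Node G → Set
SplitNode G v = 1 < outDeg G v

Bivalent : (G : Graph) → Node G → Set
Bivalent G v = JoinNode G v × SplitNode G v

BiunivocalNode : (G : Graph) → Node G → Set
BiunivocalNode G v = ¬ JoinNode G v × ¬ SplitNode G v

BiunivocalArc : (G : Graph) → Arc G → Set
BiunivocalArc G e = inDeg G (head G e) ≡ 1 × outDeg G (tail G e) ≡ 1

Compressed : Graph → Set
Compressed G = (∀ v → ¬ BiunivocalNode G v) × (∀ e → ¬ BiunivocalArc G e)

-- A non-empty arc sequence e_0 … e_ℓ (ℓ+1 arcs).
ArcSeq : Graph → ℕ → Set
ArcSeq G ℓ = Fin (suc ℓ) → Arc G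

IsWalk : (G : Graph) {ℓ : ℕ} → ArcSeq G ℓ → Set
IsWalk G {ℓ} W = (i : Fin ℓ) → head G (W (inject₁ i)) ≡ tail G (W (suc i))

nodeAt : (G : Graph) {ℓ : ℕ} → ArcSeq G ℓ → Fin (suc (suc ℓ)) → Node G
nodeAt G W zero    = tail G (W zero)
nodeAt G W (suc k) = head G (W k)

firstNode : (G : Graph) {ℓ : ℕ} → ArcSeq G ℓ → Node G
firstNode G W = tail G (W zero)

lastArc : (G : Graph) {ℓ : ℕ} → ArcSeq G ℓ → Arc G
lastArc G {ℓ} W = W (fromℕ ℓ)

lastNode : (G : Graph) {ℓ : ℕ} → ArcSeq G ℓ → Node G
lastNode G W = head G (lastArc G W)

IsPath : (G : Graph) {ℓ : ℕ} → ArcSeq G ℓ → Set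
IsPath G {ℓ} W = IsWalk G W ×
  ((a b : Fin (suc (suc ℓ))) → toℕ a < toℕ b → nodeAt G W a ≡ nodeAt G W b →
     toℕ a ≡ 0 × toℕ b ≡ suc ℓ)

WalkFromTo : (G : Graph) → Node G → Node G → Set
WalkFromTo G s t = Σ ℕ λ ℓ → Σ (ArcSeq G ℓ) λ W →
  IsWalk G W × firstNode G W ≡ s × lastNode G W ≡ t

StronglyConnected : Graph → Set
StronglyConnected G = (s t : Node G) → s ≡ t ⊎ WalkFromTo G s t

IsClosedPath : Graph → Set
IsClosedPath G = Σ ℕ λ ℓ → Σ (ArcSeq G ℓ) λ P →
  IsPath G P × firstNode G P ≡ lastNode G P ×
  ((e : Arc G) → ∃ λ i → P i ≡ e) ×
  ((v : Node G) → ∃ λ i → nodeAt G P i ≡ v)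

-- W = e_0 … e_ℓ is an omnitig: it is a walk and for all 1 ≤ i ≤ j ≤ ℓ
-- (here a = i-1, so 0 ≤ a < j ≤ ℓ) there is no non-empty path from t(e_j)
-- to h(e_a) whose first arc differs from e_j and last arc differs from e_a.
Omnitig : (G : Graph) {ℓ : ℕ} → ArcSeq G ℓ → Set
Omnitig G {ℓ} W = IsWalk G W ×
  ((a j : Fin (suc ℓ)) → toℕ a < toℕ j →
    (k : ℕ) (P : ArcSeq G k) →
    ¬ (IsPath G P × firstNode G P ≡ tail G (W j) × lastNode G P ≡ head G (W a)
       × P zero ≢ W j × lastArc G P ≢ W a))

-- u occurs at least twice among the internal nodes v_1 … v_ℓ = h(e_0) … h(e_{ℓ-1})
TwiceInternal : (G : Graph) {ℓ : ℕ} → ArcSeq G ℓ → Node G → Set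
TwiceInternal G {ℓ} W u = Σ (Fin (suc ℓ)) λ a → Σ (Fin (suc ℓ)) λ b →
  toℕ a < toℕ b × toℕ b < ℓ × head G (W a) ≡ u × head G (W b) ≡ u

-- Take u = h(e_a) = h(e_c) with a < c < ℓ such that u is not an internal node of the cycle
-- C = e_{a+1} … e_c. In each case below we find a walk whose end nodes are not internal to
-- it; shortcutting repeated internal nodes turns it into a path with the same first and last
-- arcs, and that path violates the omnitig condition.
-- If e_{c+1} = e_{a+1}, follow a second out-arc of u until the walk first meets C: a forbidden
-- path from t(e_{c+1}) into C. If e_c ≠ e_a, C itself is forbidden from t(e_{c+1}) to h(e_a).
-- Otherwise a second in-arc of u closes a cycle at u that is forbidden either for the pair
-- (e_c, e_{c+1}) or for the pair (e_a, e_{a+1}).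
module Submission where

open import Defs
open import Data.Nat using (ℕ; zero; suc; _+_; _∸_; _≤_; _<_; z≤n; s≤s; _<?_; _≤?_)
open import Data.Nat.Properties
open import Data.Nat.Induction using (<-rec)
open import Data.Fin using (toℕ; fromℕ<; fromℕ; inject₁) renaming (_≟_ to _≟ᶠ_)
import Data.Fin as Fin
open import Data.Fin.Properties using (toℕ-fromℕ<; fromℕ<-toℕ; toℕ<n; toℕ-inject₁; toℕ-fromℕ)
open import Data.List using ([]; _∷_; length; allFin)
open import Data.List.Relation.Unary.All using (All; _∷_)
open import Data.List.Relation.Unary.All.Properties using (all-filter)
open import Data.List.Relation.Unary.AllPairs using (_∷_)
open import Data.List.Relation.Unary.Unique.Propositional using (Unique)
open import Data.List.Relation.Unary.Unique.Propositional.Properties using (allFin⁺; filter⁺)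
open import Data.Product using (∃; ∃₂; _×_; _,_; proj₁; proj₂)
open import Data.Sum using (_⊎_; inj₁; inj₂)
open import Data.Empty using (⊥; ⊥-elim)
open import Relation.Nullary using (¬_; Dec; yes; no)
open import Relation.Unary using (Decidable)
open import Relation.Binary using (DecidableEquality; tri<; tri≈; tri>)
open import Relation.Binary.PropositionalEquality
open ≡-Reasoning

module _ {p} {P : ℕ → Set p} (P? : Decidable P) where

  least : ∀ v → (∃ λ n → n < v × P n) → ∃ λ n → n < v × P n × (∀ m → m < n → ¬ P m)
  least (suc v) (n , n<1+v , Pn) with anyUpTo? P? v
  ... | yes below with least v below
  ...   | m , m<v , Pm , minimal = m , m<n⇒m<1+n m<v , Pm , minimal
  least (suc v) (n , n<1+v , Pn) | no ¬below =
    v , ≤-refl , subst P n≡v Pn , λ m m<v Pm → ¬below (m , m<v , Pm)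
    where
    n≡v : n ≡ v
    n≡v = ≤-antisym (≤-pred n<1+v) (≮⇒≥ λ n<v → ¬below (n , n<v , Pn))

  greatest : ∀ v → (∃ λ n → n < v × P n) → ∃ λ n → n < v × P n × (∀ m → n < m → m < v → ¬ P m)
  greatest (suc v) (n , n<1+v , Pn) with P? v
  ... | yes Pv = v , ≤-refl , Pv , λ m v<m m<1+v _ → <⇒≱ v<m (≤-pred m<1+v)
  ... | no ¬Pv with greatest v (n , ≤∧≢⇒< (≤-pred n<1+v) (λ { refl → ¬Pv Pn }) , Pn)
  ...   | g , g<v , Pg , maximal = g , m<n⇒m<1+n g<v , Pg , above
    where
    above : ∀ m → g < m → m < suc v → ¬ P m
    above m g<m m<1+v with m≤n⇒m<n∨m≡n (≤-pred m<1+v)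
    ... | inj₁ m<v  = maximal m g<m m<v
    ... | inj₂ refl = ¬Pv

another-member : ∀ {a} {A : Set a} {P : A → Set} → DecidableEquality A →
          ∀ {xs} → All P xs → Unique xs → 1 < length xs → ∀ x₀ → ∃ λ x → P x × x ≢ x₀
another-member _≟_ {x ∷ y ∷ _} (Px ∷ Py ∷ _) ((x≢y ∷ _) ∷ _) _ x₀ with x ≟ x₀
... | yes refl = y , Py , λ y≡x → x≢y (sym y≡x)
... | no x≢x₀  = x , Px , x≢x₀
another-member _ {_ ∷ []} _ _ (s≤s ()) _

another-in-arc : ∀ G {u} → JoinNode G u → ∀ e₀ → ∃ λ e → head G e ≡ u × e ≢ e₀
another-in-arc G {u} = another-member _≟ᶠ_ (all-filter (λ e → head G e ≟ᶠ u) (allFin (E G)))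
                                    (filter⁺ (λ e → head G e ≟ᶠ u) (allFin⁺ (E G)))

another-out-arc : ∀ G {u} → SplitNode G u → ∀ e₀ → ∃ λ e → tail G e ≡ u × e ≢ e₀
another-out-arc G {u} = another-member _≟ᶠ_ (all-filter (λ e → tail G e ≟ᶠ u) (allFin (E G)))
                                     (filter⁺ (λ e → tail G e ≟ᶠ u) (allFin⁺ (E G)))

-- Walks f 0 … f n are handled as functions on ℕ whose values beyond n are irrelevant.
module Walks (G : Graph) where

  tl hd : Arc G → Node G
  tl = tail G
  hd = head G

  node : (ℕ → Arc G) → ℕ → Node G
  node f zero    = tl (f 0)
  node f (suc k) = hd (f k)

  IsWalkℕ : ℕ → (ℕ → Arc G) → Set
  IsWalkℕ n f = ∀ i → i < n → hd (f i) ≡ tl (f (suc i))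

  IsPathℕ : ℕ → (ℕ → Arc G) → Set
  IsPathℕ n f = IsWalkℕ n f ×
    (∀ a b → a < b → b ≤ suc n → node f a ≡ node f b → a ≡ 0 × b ≡ suc n)

  EndsNotInternal : ℕ → (ℕ → Arc G) → Set
  EndsNotInternal n f = ∀ i → i < n → hd (f i) ≢ tl (f 0) × hd (f i) ≢ hd (f n)

  IsWalkℕ-≤ : ∀ {m n f} → m ≤ n → IsWalkℕ n f → IsWalkℕ m f
  IsWalkℕ-≤ m≤n wf i i<m = wf i (<-≤-trans i<m m≤n)

  IsWalkℕ-drop : ∀ q {n f} → IsWalkℕ (q + n) f → IsWalkℕ n (λ r → f (q + r))
  IsWalkℕ-drop q {f = f} wf i i<n =
    trans (wf (q + i) (+-monoʳ-< q i<n)) (cong (λ x → tl (f x)) (sym (+-suc q i)))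

  closed-ends : ∀ {u n f} → tl (f 0) ≡ u → hd (f n) ≡ u → (∀ i → i < n → hd (f i) ≢ u) →
                EndsNotInternal n f
  closed-ends refl hn≡u avoid i i<n = avoid i i<n , λ eq → avoid i i<n (trans eq hn≡u)

  append : ℕ → (ℕ → Arc G) → (ℕ → Arc G) → ℕ → Arc G
  append n f g k with k ≤? n
  ... | yes _ = f k
  ... | no  _ = g (k ∸ suc n)

  append-≤ : ∀ n f g {k} → k ≤ n → append n f g k ≡ f k
  append-≤ n f g {k} k≤n with k ≤? n
  ... | yes _   = refl
  ... | no  k≰n = ⊥-elim (k≰n k≤n)

  append-+ : ∀ n f g s → append n f g (suc n + s) ≡ g s
  append-+ n f g s with suc n + s ≤? n
  ... | yes 1+n+s≤n = ⊥-elim (<⇒≱ (s≤s (m≤m+n n s)) 1+n+s≤n)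
  ... | no  _       = cong g (m+n∸m≡n (suc n) s)

  append-view : ∀ n f g k →
    (k ≤ n × append n f g k ≡ f k) ⊎ (∃ λ s → k ≡ suc n + s × append n f g k ≡ g s)
  append-view n f g k = view (k ≤? n)
    where
    view : Dec (k ≤ n) →
           (k ≤ n × append n f g k ≡ f k) ⊎ (∃ λ s → k ≡ suc n + s × append n f g k ≡ g s)
    view (yes k≤n) = inj₁ (k≤n , append-≤ n f g k≤n)
    view (no k≰n) with m≤n⇒∃[o]m+o≡n (≰⇒> k≰n)
    ... | s , refl = inj₂ (s , refl , append-+ n f g s)

  append-walk : ∀ {n m f g} → IsWalkℕ n f → IsWalkℕ m g → hd (f n) ≡ tl (g 0) →
                IsWalkℕ (suc n + m) (append n f g)
  append-walk {n} {m} {f} {g} wf wg joint i i< with <-cmp i n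
  ... | tri< i<n _ _ = begin
    hd (append n f g i)       ≡⟨ cong hd (append-≤ n f g (<⇒≤ i<n)) ⟩
    hd (f i)                  ≡⟨ wf i i<n ⟩
    tl (f (suc i))            ≡⟨ cong tl (append-≤ n f g i<n) ⟨
    tl (append n f g (suc i)) ∎
  ... | tri≈ _ refl _ = begin
    hd (append n f g n)           ≡⟨ cong hd (append-≤ n f g ≤-refl) ⟩
    hd (f n)                      ≡⟨ joint ⟩
    tl (g 0)                      ≡⟨ cong tl (append-+ n f g 0) ⟨
    tl (append n f g (suc n + 0)) ≡⟨ cong (λ x → tl (append n f g (suc x))) (+-identityʳ n) ⟩
    tl (append n f g (suc n))     ∎
  ... | tri> _ _ n<i with m≤n⇒∃[o]m+o≡n n<i
  ...   | s , refl = begin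
    hd (append n f g (suc n + s))       ≡⟨ cong hd (append-+ n f g s) ⟩
    hd (g s)                            ≡⟨ wg s (+-cancelˡ-< (suc n) s m i<) ⟩
    tl (g (suc s))                      ≡⟨ cong tl (append-+ n f g (suc s)) ⟨
    tl (append n f g (suc n + suc s))   ≡⟨ cong (λ x → tl (append n f g x)) (+-suc (suc n) s) ⟩
    tl (append n f g (suc (suc n + s))) ∎

  -- The witness is the suffix after the last departure from u.
  last-return : ∀ {u n f} → IsWalkℕ n f → tl (f 0) ≡ u → hd (f n) ≡ u →
    ∃₂ λ m g → IsWalkℕ m g × tl (g 0) ≡ u × g m ≡ f n × (∀ r → r < m → hd (g r) ≢ u)
  last-return {u} {n} {f} wf f0 fn with greatest (λ q → tl (f q) ≟ᶠ u) (suc n) (0 , s≤s z≤n , f0)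
  ... | q , q<1+n , tq , later with m≤n⇒∃[o]m+o≡n (≤-pred q<1+n)
  ... | m , refl =
    m , (λ r → f (q + r)) , IsWalkℕ-drop q wf ,
    trans (cong (λ x → tl (f x)) (+-identityʳ q)) tq , refl , avoid
    where
    avoid : ∀ r → r < m → hd (f (q + r)) ≢ u
    avoid r r<m eq = later (suc (q + r)) (s≤s (m≤m+n q r)) (s≤s (+-monoʳ-< q r<m))
      (trans (sym (wf (q + r) (+-monoʳ-< q r<m))) eq)

  Repeat : ℕ → (ℕ → Arc G) → Set
  Repeat n f = ∃ λ j → j < n × ∃ λ i → i < j × hd (f i) ≡ hd (f j)

  repeat? : ∀ n f → Dec (Repeat n f)
  repeat? n f = anyUpTo? (λ j → anyUpTo? (λ i → hd (f i) ≟ᶠ hd (f j)) j) n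

  noRepeat⇒path : ∀ {n f} → IsWalkℕ n f → EndsNotInternal n f → ¬ Repeat n f → IsPathℕ n f
  noRepeat⇒path {n} {f} wf ends ¬rep = wf , distinct
    where
    distinct : ∀ a b → a < b → b ≤ suc n → node f a ≡ node f b → a ≡ 0 × b ≡ suc n
    distinct zero (suc b) _ b≤1+n eq with m≤n⇒m<n∨m≡n (≤-pred b≤1+n)
    ... | inj₁ b<n  = ⊥-elim (proj₁ (ends b b<n) (sym eq))
    ... | inj₂ refl = refl , refl
    distinct (suc a) (suc b) a<b b≤1+n eq with m≤n⇒m<n∨m≡n (≤-pred b≤1+n)
    ... | inj₁ b<n  = ⊥-elim (¬rep (b , b<n , a , ≤-pred a<b , eq))
    ... | inj₂ refl = ⊥-elim (proj₂ (ends a (≤-pred a<b)) eq)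

  -- The witness cuts out the closed subwalk between the two repeated internal nodes.
  shortcut : ∀ {n f} → IsWalkℕ n f → EndsNotInternal n f → Repeat n f →
             ∃₂ λ m g → m < n × IsWalkℕ m g × EndsNotInternal m g × g 0 ≡ f 0 × g m ≡ f n
  shortcut {n} {f} wf ends (j , j<n , i , i<j , same) with m≤n⇒∃[o]m+o≡n j<n
  ... | r , refl = suc i + r , g , +-monoˡ-< r (s≤s i<j) , walk , ends′ , first , last
    where
    g : ℕ → Arc G
    g = append i f (λ s → f (suc j + s))
    first : g 0 ≡ f 0
    first = append-≤ i f (λ s → f (suc j + s)) z≤n
    last : g (suc i + r) ≡ f (suc j + r)
    last = append-+ i f _ r
    joint : hd (f i) ≡ tl (f (suc j + 0))
    joint = trans same (trans (wf j j<n) (cong (λ x → tl (f (suc x))) (sym (+-identityʳ j))))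
    walk : IsWalkℕ (suc i + r) g
    walk = append-walk (IsWalkℕ-≤ (<⇒≤ (<-trans i<j j<n)) wf) (IsWalkℕ-drop (suc j) wf) joint
    internal : ∀ k → k < suc i + r → ∃ λ k′ → k′ < suc j + r × hd (g k) ≡ hd (f k′)
    internal k k< with append-view i f _ k
    ... | inj₁ (k≤i , eq)      = k , ≤-<-trans k≤i (<-trans i<j j<n) , cong hd eq
    ... | inj₂ (s , refl , eq) =
      suc j + s , +-monoʳ-< (suc j) (+-cancelˡ-< (suc i) s r k<) , cong hd eq
    ends′ : EndsNotInternal (suc i + r) g
    ends′ k k< with internal k k<
    ... | k′ , k′< , eq =
      (λ e → proj₁ (ends k′ k′<) (trans (sym eq) (trans e (cong tl first)))) ,
      (λ e → proj₂ (ends k′ k′<) (trans (sym eq) (trans e (cong hd last))))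

  PathWithEnds : ℕ → (ℕ → Arc G) → Set
  PathWithEnds n f = ∃₂ λ m g → IsPathℕ m g × g 0 ≡ f 0 × g m ≡ f n

  walk⇒path : ∀ n {f} → IsWalkℕ n f → EndsNotInternal n f → PathWithEnds n f
  walk⇒path = <-rec Goal step
    where
    Goal : ℕ → Set
    Goal n = ∀ {f} → IsWalkℕ n f → EndsNotInternal n f → PathWithEnds n f
    step : ∀ n → (∀ {m} → m < n → Goal m) → Goal n
    step n rec {f} wf ends with repeat? n f
    ... | no ¬rep = n , f , noRepeat⇒path wf ends ¬rep , refl , refl
    ... | yes rep with shortcut wf ends rep
    ...   | m , g , m<n , wg , ends′ , g0 , gm with rec m<n wg ends′
    ...     | k , p , path , p0 , pk = k , p , path , trans p0 g0 , trans pk gm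

  arcs : ∀ {ℓ} → ArcSeq G ℓ → ℕ → Arc G
  arcs {ℓ} W k with k <? suc ℓ
  ... | yes k<1+ℓ = W (fromℕ< k<1+ℓ)
  ... | no  _     = W Fin.zero

  arcs-at : ∀ {ℓ} (W : ArcSeq G ℓ) i {k} → toℕ i ≡ k → arcs W k ≡ W i
  arcs-at {ℓ} W i refl with toℕ i <? suc ℓ
  ... | yes i<1+ℓ = cong W (fromℕ<-toℕ i i<1+ℓ)
  ... | no  i≮1+ℓ = ⊥-elim (i≮1+ℓ (toℕ<n i))

  arcs-walk : ∀ {ℓ} {W : ArcSeq G ℓ} → IsWalk G W → IsWalkℕ ℓ (arcs W)
  arcs-walk {W = W} wW i i<ℓ = begin
    hd (arcs W i)       ≡⟨ cong hd (arcs-at W (inject₁ fi) (trans (toℕ-inject₁ fi) (toℕ-fromℕ< i<ℓ))) ⟩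
    hd (W (inject₁ fi)) ≡⟨ wW fi ⟩
    tl (W (Fin.suc fi)) ≡⟨ cong tl (arcs-at W (Fin.suc fi) (cong suc (toℕ-fromℕ< i<ℓ))) ⟨
    tl (arcs W (suc i)) ∎
    where fi = fromℕ< i<ℓ

  walkℕ : ∀ {s t} → WalkFromTo G s t → ∃₂ λ n f → IsWalkℕ n f × tl (f 0) ≡ s × hd (f n) ≡ t
  walkℕ (ℓ , W , wW , first , last) =
    ℓ , arcs W , arcs-walk wW ,
    trans (cong tl (arcs-at W Fin.zero refl)) first ,
    trans (cong hd (arcs-at W (fromℕ ℓ) (toℕ-fromℕ ℓ))) last

  toArcSeq : ∀ m → (ℕ → Arc G) → ArcSeq G m
  toArcSeq m g i = g (toℕ i)

  path⇒IsPath : ∀ {m g} → IsPathℕ m g → IsPath G (toArcSeq m g)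
  path⇒IsPath {m} {g} (wg , distinct) = walk , λ a b a<b eq →
    distinct (toℕ a) (toℕ b) a<b (≤-pred (toℕ<n b)) (trans (sym (node-at a)) (trans eq (node-at b)))
    where
    walk : IsWalk G (toArcSeq m g)
    walk i = trans (cong (λ x → hd (g x)) (toℕ-inject₁ i)) (wg (toℕ i) (toℕ<n i))
    node-at : ∀ i → nodeAt G (toArcSeq m g) i ≡ node g (toℕ i)
    node-at Fin.zero    = refl
    node-at (Fin.suc i) = refl

  walk-from-arc : StronglyConnected G → ∀ e t →
                  ∃₂ λ n f → IsWalkℕ n f × f 0 ≡ e × hd (f n) ≡ t
  walk-from-arc sc e t with sc (hd e) t
  ... | inj₁ he≡t = 0 , (λ _ → e) , (λ _ ()) , refl , he≡t
  ... | inj₂ walk with walkℕ walk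
  ...   | m , f , wf , f0 , fm =
    suc m , append 0 (λ _ → e) f , append-walk (λ _ ()) wf (sym f0) ,
    append-≤ 0 (λ _ → e) f z≤n , trans (cong hd (append-+ 0 (λ _ → e) f m)) fm

  walk-to-arc : StronglyConnected G → ∀ s e →
                ∃₂ λ n f → IsWalkℕ n f × tl (f 0) ≡ s × f n ≡ e
  walk-to-arc sc s e with sc s (tl e)
  ... | inj₁ s≡te = 0 , (λ _ → e) , (λ _ ()) , sym s≡te , refl
  ... | inj₂ walk with walkℕ walk
  ...   | m , f , wf , f0 , fm =
    suc m + 0 , append m f (λ _ → e) , append-walk wf (λ _ ()) fm ,
    trans (cong tl (append-≤ m f (λ _ → e) z≤n)) f0 , append-+ m f (λ _ → e) 0

  no-forbidden-walk : ∀ {ℓ} {W : ArcSeq G ℓ} → Omnitig G W → ∀ {i j} → i < j → j ≤ ℓ →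
    ∀ {n f} → IsWalkℕ n f → EndsNotInternal n f →
    tl (f 0) ≡ tl (arcs W j) → hd (f n) ≡ hd (arcs W i) → f 0 ≢ arcs W j → f n ≢ arcs W i → ⊥
  no-forbidden-walk {ℓ} {W} (_ , forbidden) {i} {j} i<j j≤ℓ {n} {f} wf ends start end first≢ last≢
    with walk⇒path n wf ends
  ... | m , g , path , g0 , gm =
    forbidden a b a<b m (toArcSeq m g)
      ( path⇒IsPath path
      , trans (cong tl g0) (trans start (cong tl eb))
      , trans (cong hd last-arc) (trans end (cong hd ea))
      , (λ e → first≢ (trans (sym g0) (trans e (sym eb))))
      , (λ e → last≢ (trans (sym last-arc) (trans e (sym ea)))))
    where
    a = fromℕ< (<-≤-trans i<j (m≤n⇒m≤1+n j≤ℓ))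
    b = fromℕ< (s≤s j≤ℓ)
    ea : arcs W i ≡ W a
    ea = arcs-at W a (toℕ-fromℕ< _)
    eb : arcs W j ≡ W b
    eb = arcs-at W b (toℕ-fromℕ< _)
    a<b : toℕ a < toℕ b
    a<b = subst₂ _<_ (sym (toℕ-fromℕ< _)) (sym (toℕ-fromℕ< _)) i<j
    last-arc : g (toℕ (fromℕ m)) ≡ f n
    last-arc = trans (cong g (toℕ-fromℕ m)) gm

open Walks using (arcs; arcs-at)

module FirstReturn (G : Graph) (sc : StronglyConnected G) {u : Node G} (biv : Bivalent G u)
  {ℓ : ℕ} {W : ArcSeq G ℓ} (om : Omnitig G W) {a k : ℕ} (c<ℓ : suc (a + k) < ℓ)
  (u-at-a : head G (arcs G W a) ≡ u) (u-at-c : head G (arcs G W (suc (a + k))) ≡ u)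
  (u-avoided : ∀ r → r < k → head G (arcs G W (suc (a + r))) ≢ u) where

  open Walks G hiding (arcs)

  w : ℕ → Arc G
  w = arcs G W

  c : ℕ
  c = suc (a + k)

  loop : ℕ → Arc G
  loop r = w (suc (a + r))

  a<ℓ : a < ℓ
  a<ℓ = <-trans (s≤s (m≤m+n a k)) c<ℓ

  u-after : ∀ {i} → i < ℓ → hd (w i) ≡ u → tl (w (suc i)) ≡ u
  u-after i<ℓ eq = trans (sym (arcs-walk (proj₁ om) _ i<ℓ)) eq

  loop-first : loop 0 ≡ w (suc a)
  loop-first = cong (λ x → w (suc x)) (+-identityʳ a)

  loop-walk : IsWalkℕ k loop
  loop-walk = IsWalkℕ-drop (suc a) (IsWalkℕ-≤ (<⇒≤ c<ℓ) (arcs-walk (proj₁ om)))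

  loop-starts : tl (loop 0) ≡ u
  loop-starts = trans (cong tl loop-first) (u-after a<ℓ u-at-a)

  no-forbidden-cycle : ∀ {i j} → i < j → j ≤ ℓ → hd (w i) ≡ u → tl (w j) ≡ u →
    ∀ {n f} → IsWalkℕ n f → tl (f 0) ≡ u → hd (f n) ≡ u → (∀ r → r < n → hd (f r) ≢ u) →
    f 0 ≢ w j → f n ≢ w i → ⊥
  no-forbidden-cycle i<j j≤ℓ wi wj wf f0 fn avoid =
    no-forbidden-walk om i<j j≤ℓ wf (closed-ends f0 fn avoid) (trans f0 (sym wj)) (trans fn (sym wi))

  loop-forbidden : w (suc c) ≢ w (suc a) → w c ≢ w a → ⊥
  loop-forbidden after≢ before≢ =
    no-forbidden-cycle (s≤s (m≤n⇒m≤1+n (m≤m+n a k))) c<ℓ u-at-a (u-after c<ℓ u-at-c)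
      loop-walk loop-starts u-at-c u-avoided (λ eq → after≢ (trans (sym eq) loop-first)) before≢

  OnLoop : Node G → Set
  OnLoop x = ∃ λ r → r < suc k × hd (loop r) ≡ x

  u-onLoop : OnLoop u
  u-onLoop = k , ≤-refl , u-at-c

  tail-onLoop : ∀ r → r < suc k → OnLoop (tl (loop r))
  tail-onLoop zero    _  = subst OnLoop (sym loop-starts) u-onLoop
  tail-onLoop (suc r) r< = r , m<n⇒m<1+n (≤-pred r<) , loop-walk r (≤-pred r<)

  entering-arc-off-loop : ∀ {n h} → IsWalkℕ n h → tl (h 0) ≡ u → h 0 ≢ loop 0 →
    ∀ p → p ≤ n → (∀ q → q < p → ¬ OnLoop (hd (h q))) → ∀ r → r < suc k → h p ≢ loop r
  entering-arc-off-loop _  _  h0≢ zero _ _ zero    _  eq = h0≢ eq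
  entering-arc-off-loop _  h0 _   zero _ _ (suc r) r< eq =
    u-avoided r (≤-pred r<) (trans (loop-walk r (≤-pred r<)) (trans (cong tl (sym eq)) h0))
  entering-arc-off-loop wh _ _ (suc q) q<n off r r< eq =
    off q ≤-refl (subst OnLoop (trans (cong tl (sym eq)) (sym (wh q q<n))) (tail-onLoop r r<))

  reentry-forbidden : w (suc c) ≡ w (suc a) → ⊥
  reentry-forbidden after≡ with another-out-arc G (proj₂ biv) (w (suc a))
  ... | e , te≡u , e≢ with walk-from-arc sc e u
  ... | n , h , wh , h0 , hn
    with least (λ p → anyUpTo? (λ r → hd (loop r) ≟ᶠ hd (h p)) (suc k)) (suc n)
               (n , ≤-refl , subst OnLoop (sym hn) u-onLoop)
  ... | p , p<1+n , (r , r<1+k , enter) , off =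
    no-forbidden-walk om (s≤s (s≤s (+-monoʳ-≤ a (≤-pred r<1+k)))) c<ℓ
      (IsWalkℕ-≤ (≤-pred p<1+n) wh) ends start (sym enter)
      (λ eq → e≢ (trans (sym h0) (trans eq after≡)))
      (entering-arc-off-loop wh h-starts (λ eq → e≢ (trans (sym h0) (trans eq loop-first)))
         p (≤-pred p<1+n) off r r<1+k)
    where
    h-starts : tl (h 0) ≡ u
    h-starts = trans (cong tl h0) te≡u
    start : tl (h 0) ≡ tl (w (suc c))
    start = trans h-starts (sym (u-after c<ℓ u-at-c))
    ends : EndsNotInternal p h
    ends q q<p =
      (λ eq → off q q<p (subst OnLoop (sym (trans eq h-starts)) u-onLoop)) ,
      (λ eq → off q q<p (subst OnLoop (sym eq) (r , r<1+k , enter)))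

  closing-forbidden : w c ≡ w a → w (suc c) ≢ w (suc a) → ⊥
  closing-forbidden before≡ after≢ with another-in-arc G (proj₁ biv) (w a)
  ... | e , he≡u , e≢ with walk-to-arc sc u e
  ... | n , h , wh , h0 , hn with last-return wh h0 (trans (cong hd hn) he≡u)
  ... | m , g , wg , g0 , gm , avoid = forbidden (g 0 ≟ᶠ w (suc a))
    where
    g-ends : g m ≡ e
    g-ends = trans gm hn
    g-closes : hd (g m) ≡ u
    g-closes = trans (cong hd g-ends) he≡u
    forbidden : Dec (g 0 ≡ w (suc a)) → ⊥
    forbidden (yes first≡) =
      no-forbidden-cycle ≤-refl c<ℓ u-at-c (u-after c<ℓ u-at-c) wg g0 g-closes avoid
        (λ eq → after≢ (trans (sym eq) first≡)) (λ eq → e≢ (trans (sym g-ends) (trans eq before≡)))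
    forbidden (no first≢) =
      no-forbidden-cycle ≤-refl a<ℓ u-at-a (u-after a<ℓ u-at-a) wg g0 g-closes avoid
        first≢ (λ eq → e≢ (trans (sym g-ends) eq))

  impossible : ⊥
  impossible with w (suc c) ≟ᶠ w (suc a) | w c ≟ᶠ w a
  ... | yes after≡ | _           = reentry-forbidden after≡
  ... | no after≢  | no before≢  = loop-forbidden after≢ before≢
  ... | no after≢  | yes before≡ = closing-forbidden before≡ after≢

lemma12 : (G : Graph) → StronglyConnected G → Compressed G → ¬ IsClosedPath G →
          (u : Node G) → Bivalent G u →
          (ℓ : ℕ) (W : ArcSeq G ℓ) → Omnitig G W → ¬ TwiceInternal G W u
lemma12 G sc _ _ u biv ℓ W om (a , b , a<b , b<ℓ , u-at-a , u-at-b) with m≤n⇒∃[o]m+o≡n a<b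
... | δ , a+1+δ≡b
  with least (λ k → head G (arcs G W (suc (toℕ a + k))) ≟ᶠ u) (suc δ)
             (δ , ≤-refl , trans (cong (head G) (arcs-at G W b (sym a+1+δ≡b))) u-at-b)
... | k , k<1+δ , u-at-c , first =
  FirstReturn.impossible G sc biv om c<ℓ (trans (cong (head G) (arcs-at G W a refl)) u-at-a) u-at-c first
  where
  c<ℓ : suc (toℕ a + k) < ℓ
  c<ℓ = ≤-<-trans (subst (suc (toℕ a + k) ≤_) a+1+δ≡b (s≤s (+-monoʳ-≤ (toℕ a) (≤-pred k<1+δ)))) b<ℓ
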